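{- Let $m,n$ be positive integers with $\gcd(m,n)=1$ and put $l=\gcd(m-1,n)$. Let $D,E,F\in\mathbb{Z}$ and suppose that $$P(x,y)=\frac{n}{2}\Big(x-\frac{m-1}{n}y\Big)^2+\Big(D-\frac n2\Big)x+\Big(E-\frac{(m-1)^2}{2n}\Big)y+F$$ is a quadratic packing polynomial on $I(n/m)$. Define $$k:=\Big(D-\frac n2\Big)\frac{m-1}{l}+\Big(E-\frac{(m-1)^2}{2n}\Big)\frac{n}{l},$$ and $\hat P(x,y):=P\big(x+\tfrac{m-1}{n}y,\,y\big)$. If $k>0$, then $\frac{n}{l}$ divides $l$, $k\equiv \frac{m-1}{l}\pmod{n/l}$, and $$\hat P(x,y)=\frac n2\,x\Big(x-\frac{kl}{n}\Big)+x+\frac{kl}{n}\,y+F.$$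
   Context: For $\alpha>0$, $I(\alpha)=\{(x,y)\in\mathbb{Z}^2: 0\le y\le \alpha x\}$. A quadratic packing polynomial (QPP) on a countable set $I\subset\mathbb{R}^2$ is a real polynomial of degree $2$ whose restriction to $I$ is a bijection from $I$ onto $\mathbb{N}_0=\{0,1,2,\dots\}$. -}

module Defs where

open import Data.Nat as ℕ using (ℕ; NonZero; _∸_)
open import Data.Nat.GCD using (gcd; gcd[m,n]≢0)
open import Data.Integer as ℤ using (ℤ; +_)
open import Data.Rational using (ℚ; _/_; _+_; _*_; _-_; _≤_; 0ℚ; ½)
open import Data.Product using (Σ; ∃; _×_; _,_)
open import Data.Sum using (inj₂)
open import Relation.Binary.PropositionalEquality using (_≡_)

ℤ→ℚ : ℤ → ℚ
ℤ→ℚ z = z / 1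

ℕ→ℚ : ℕ → ℚ
ℕ→ℚ k = (+ k) / 1

Point : Set
Point = ℤ × ℤ

InI : ℚ → Point → Set
InI α (x , y) = (0ℚ ≤ ℤ→ℚ y) × (ℤ→ℚ y ≤ α * ℤ→ℚ x)

-- a real polynomial of degree ≤ 2 in two variables with (here rational) coefficients:
-- a x² + b x y + c y² + d x + e y + f
record Quad : Set where
  constructor quad
  field a b c d e f : ℚ

eval : Quad → ℚ → ℚ → ℚ
eval (quad a b c d e f) x y =
  a * x * x + b * x * y + c * y * y + d * x + e * y + f

Degree2 : Quad → Set
Degree2 (quad a b c d e f) = ¬ ((a ≡ 0ℚ) × (b ≡ 0ℚ) × (c ≡ 0ℚ))
  where open import Relation.Nullary using (¬_)

RestrictsToBijection : ℚ → Quad → Set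
RestrictsToBijection α q =
  ((p : Point) → InI α p → ∃ λ (N : ℕ) → evalP p ≡ ℕ→ℚ N)
  × ((p p′ : Point) → InI α p → InI α p′ → evalP p ≡ evalP p′ → p ≡ p′)
  × ((N : ℕ) → ∃ λ (p : Point) → InI α p × (evalP p ≡ ℕ→ℚ N))
  where
  evalP : Point → ℚ
  evalP (x , y) = eval q (ℤ→ℚ x) (ℤ→ℚ y)

IsQPP : ℚ → Quad → Set
IsQPP α q = Degree2 q × RestrictsToBijection α q

gcdNZ : (m n : ℕ) → .{{NonZero n}} → NonZero (gcd (m ∸ 1) n)
gcdNZ m n@(ℕ.suc _) = ℕ.≢-nonZero (gcd[m,n]≢0 (m ∸ 1) n (inj₂ (λ ())))

-- The polynomial P of Proposition 6, as a Quad.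
-- P(x,y) = n/2 (x - (m-1)/n y)² + (D - n/2) x + (E - (m-1)²/(2n)) y + F
module Prop6 (m n : ℕ) .{{_ : NonZero m}} .{{_ : NonZero n}} (D E F : ℤ) where
  l : ℕ
  l = gcd (m ∸ 1) n

  instance
    l≢0 : NonZero l
    l≢0 = gcdNZ m n

  n/2 : ℚ
  n/2 = (+ n) / 2

  r : ℚ
  r = (+ (m ∸ 1)) / n

  dd : ℚ
  dd = ℤ→ℚ D - n/2

  ee : ℚ
  ee = ℤ→ℚ E - ((+ ((m ∸ 1) ℕ.* (m ∸ 1))) / n) * ½

  P : Quad
  P = quad n/2 (ℤ→ℚ (ℤ.- (+ 2)) * n/2 * r) (n/2 * r * r) dd ee (ℤ→ℚ F)

  k : ℚ
  k = dd * ((+ (m ∸ 1)) / l) + ee * ((+ n) / l)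

  Phat : ℚ → ℚ → ℚ
  Phat x y = eval P (x + r * y) y

  target : ℚ → ℚ → ℚ
  target x y = n/2 * x * (x - k * ℕ→ℚ l * (+ 1 / n)) + x
             + k * ℕ→ℚ l * (+ 1 / n) * y + ℤ→ℚ F

{-# OPTIONS --safe #-}
module Submission where

-- In the coordinates w = n x − (m − 1) y the wedge I(n/m) becomes {0 ≤ y ≤ w}, and
-- 2n P = w² + α w + β y + 2n F with α = 2D − n and β ∈ ℤ.  Write n = l g and m − 1 = l ρ,
-- so that g and ρ are coprime.  The translation (x, y) ↦ (x + ρ, y + g) preserves w and
-- raises P by K = β / 2l, which turns out to equal k.  As P enumerates ℕ₀ bijectively, the
-- value P + K of the top point of a long fibre {w = const} must be taken at the bottom of the
-- fibre w + K l, and comparing the quadratic terms gives 2 (w − y + y′) + α + K l = 2 g.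
-- Two such fibres, one with w ≡ 0 and one with w ≡ −l ρ (mod l g), force α = 2 − K l,
-- g ∣ l and K ≡ ρ (mod g); the formula for P̂ is then an identity between rationals.

open import Algebra.Bundles using (CommutativeMonoid)
open import Data.Empty using (⊥-elim)
open import Data.Integer as ℤ using (ℤ; +_; -[1+_]; 0ℤ; +≤+; -≤+; +<+)
open import Data.Integer.Coprimality using (Coprime; coprime-divisor)
import Data.Integer.Properties as ℤP
import Data.Integer.Tactic.RingSolver as ℤ-RingSolver
open import Data.List using (_∷_; [])
open import Data.Nat as ℕ using (ℕ; NonZero; _∸_; z≤n)
import Data.Nat.Coprimality as ℕCoprimality
open import Data.Nat.DivMod using (m≡m%n+[m/n]*n; m%n<n; m*[n/m]≡n)
import Data.Nat.Divisibility as ℕDivisibility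
open import Data.Nat.GCD using (gcd; gcd[m,n]∣m; gcd[m,n]∣n)
import Data.Nat.Properties as ℕP
open import Data.Product using (∃; ∃₂; _×_; _,_; proj₁; proj₂)
open import Data.Rational as ℚ using (ℚ; _/_; 0ℚ; 1ℚ; ½)
import Data.Rational.Properties as ℚP
import Data.Rational.Unnormalised as ℚᵘ
import Data.Rational.Unnormalised.Properties as ℚᵘP
open import Data.Sum using (_⊎_; inj₁; inj₂)
open import Relation.Binary using (Tri; tri<; tri≈; tri>)
open import Relation.Binary.PropositionalEquality
open import Relation.Nullary using (¬_)

open import Algebra.Properties.CommutativeSemigroup
  (CommutativeMonoid.commutativeSemigroup ℚP.*-1-commutativeMonoid) using (x∙yz≈y∙xz; xy∙z≈y∙xz)

open import Defs

module IntegerArithmetic where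
  open import Data.Integer using (_+_; _*_; _-_; -_; _≤_; _<_)
  open import Data.Integer.Divisibility.Signed using (_∣_; divides; ∣⇒∣ᵤ; ∣ᵤ⇒∣)
  open ℤ-RingSolver using (solve)

  0≤+ : ∀ n → 0ℤ ≤ + n
  0≤+ n = +≤+ z≤n

  0≤-+ : ∀ {a b} → 0ℤ ≤ a → 0ℤ ≤ b → 0ℤ ≤ a + b
  0≤-+ = ℤP.+-mono-≤

  0≤-* : ∀ {a b} → 0ℤ ≤ a → 0ℤ ≤ b → 0ℤ ≤ a * b
  0≤-* {+ a} {+ b} _ _ = subst (0ℤ ≤_) (ℤP.pos-* a b) (0≤+ (a ℕ.* b))

  0≤-cong : ∀ {a b} → a ≡ b → 0ℤ ≤ a → 0ℤ ≤ b
  0≤-cong = subst (0ℤ ≤_)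

  0≰-[1+n] : ∀ {n} → ¬ (0ℤ ≤ -[1+ n ])
  0≰-[1+n] ()

  ≤⇒0≤- : ∀ {a b} → a ≤ b → 0ℤ ≤ b - a
  ≤⇒0≤- = ℤP.i≤j⇒0≤j-i

  0≤-⇒≤ : ∀ {a b} → 0ℤ ≤ b - a → a ≤ b
  0≤-⇒≤ = ℤP.0≤i-j⇒j≤i

  <⇒0≤-1 : ∀ {a b} → a < b → 0ℤ ≤ b - a - + 1
  <⇒0≤-1 {a} {b} a<b = 0≤-cong b-[1+a]≡b-a-1 (≤⇒0≤- (ℤP.i<j⇒suc[i]≤j a<b))
    where
    b-[1+a]≡b-a-1 : b - (+ 1 + a) ≡ b - a - + 1
    b-[1+a]≡b-a-1 = solve (a ∷ b ∷ [])

  0≤-1⇒< : ∀ {a b} → 0ℤ ≤ b - a - + 1 → a < b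
  0≤-1⇒< {a} {b} 0≤b-a-1 = ℤP.suc[i]≤j⇒i<j (0≤-⇒≤ (0≤-cong b-a-1≡b-[1+a] 0≤b-a-1))
    where
    b-a-1≡b-[1+a] : b - a - + 1 ≡ b - (+ 1 + a)
    b-a-1≡b-[1+a] = solve (a ∷ b ∷ [])

  i<i+1 : ∀ i → i < i + + 1
  i<i+1 i = 0≤-1⇒< (0≤-cong eq (0≤+ 0))
    where
    eq : 0ℤ ≡ i + + 1 - i - + 1
    eq = solve (i ∷ [])

  i-j+j≡i : ∀ i j → i - j + j ≡ i
  i-j+j≡i i j = solve (i ∷ j ∷ [])

  +-cancelʳ : ∀ {a b} c → a + c ≡ b + c → a ≡ b
  +-cancelʳ {a} {b} c a+c≡b+c = begin
    a         ≡⟨ solve (a ∷ c ∷ []) ⟩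
    a + c - c ≡⟨ cong (_- c) a+c≡b+c ⟩
    b + c - c ≡⟨ solve (b ∷ c ∷ []) ⟩
    b         ∎
    where open ≡-Reasoning

  i≤j⇒i-k≤j : ∀ {i j k} → 0ℤ ≤ k → i ≤ j → i - k ≤ j
  i≤j⇒i-k≤j {i} {j} {k} 0≤k i≤j = 0≤-⇒≤ (0≤-cong eq (0≤-+ (≤⇒0≤- i≤j) 0≤k))
    where
    eq : (j - i) + k ≡ j - (i - k)
    eq = solve (i ∷ j ∷ k ∷ [])

  i≤j*i : ∀ {i j} → + 1 ≤ j → 0ℤ ≤ i → i ≤ j * i
  i≤j*i {i} {j} 1≤j 0≤i = 0≤-⇒≤ (0≤-cong eq (0≤-* (≤⇒0≤- 1≤j) 0≤i))
    where
    eq : (j - + 1) * i ≡ j * i - i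
    eq = solve (i ∷ j ∷ [])

  1≤-* : ∀ {a b} → + 1 ≤ a → + 1 ≤ b → + 1 ≤ a * b
  1≤-* 1≤a 1≤b = ℤP.≤-trans 1≤b (i≤j*i 1≤a (ℤP.≤-trans (0≤+ 1) 1≤b))

  b+c<s⇒b<a*s-c : ∀ {a s b c} → + 1 ≤ a → 0ℤ ≤ s → b + c < s → b < a * s - c
  b+c<s⇒b<a*s-c {a} {s} {b} {c} 1≤a 0≤s b+c<s =
    0≤-1⇒< (0≤-cong eq (0≤-+ (0≤-* (≤⇒0≤- 1≤a) 0≤s) (<⇒0≤-1 b+c<s)))
    where
    eq : (a - + 1) * s + (s - (b + c) - + 1) ≡ a * s - c - b - + 1
    eq = solve (a ∷ s ∷ b ∷ c ∷ [])

  y≤w⇒w-[y-g]≮g : ∀ {w y g} → y ≤ w → ¬ (w - (y - g) < g)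
  y≤w⇒w-[y-g]≮g {w} {y} {g} y≤w w-[y-g]<g = 0≰-[1+n] (0≤-cong sum≡-1 (0≤-+ (≤⇒0≤- y≤w) (<⇒0≤-1 w-[y-g]<g)))
    where
    sum≡-1 : (w - y) + (g - (w - (y - g)) - + 1) ≡ - + 1
    sum≡-1 = solve (w ∷ y ∷ g ∷ [])

  ∣i∣-bounds : ∀ i → i ≤ + ℤ.∣ i ∣ × - + ℤ.∣ i ∣ ≤ i
  ∣i∣-bounds (+ n)    = ℤP.≤-refl , ℤP.neg-≤-pos
  ∣i∣-bounds -[1+ n ] = -≤+ , ℤP.≤-refl

  nonNeg-divMod : ∀ z g → 0ℤ ≤ z → + 1 ≤ g → ∃₂ λ j r → z ≡ r + j * g × 0ℤ ≤ j × 0ℤ ≤ r × r < g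
  nonNeg-divMod (+ n) (+ g@(ℕ.suc _)) _ _ =
    + (n ℕ./ g) , + (n ℕ.% g) , division , 0≤+ _ , 0≤+ _ , +<+ (m%n<n n g)
    where
    division : + n ≡ + (n ℕ.% g) + + (n ℕ./ g) * + g
    division = trans (cong +_ (m≡m%n+[m/n]*n n g))
      (trans (ℤP.pos-+ (n ℕ.% g) _) (cong (λ z → + (n ℕ.% g) + z) (ℤP.pos-* (n ℕ./ g) g)))
  nonNeg-divMod (+ _)    (+ 0)    _ (+≤+ ())
  nonNeg-divMod (+ _)    -[1+ _ ] _ ()
  nonNeg-divMod -[1+ _ ] _        ()

  ∣∧0<∧≤⇒≡ : ∀ {g z} → g ∣ z → + 1 ≤ z → z ≤ g → z ≡ g
  ∣∧0<∧≤⇒≡ {g} (divides c refl) 1≤cg cg≤g = by-quotient (ℤP.<-cmp c (+ 1))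
    where
    1≤g : + 1 ≤ g
    1≤g = ℤP.≤-trans 1≤cg cg≤g
    0≤g : 0ℤ ≤ g
    0≤g = ℤP.≤-trans (0≤+ 1) 1≤g
    by-quotient : Tri (c < + 1) (c ≡ + 1) (+ 1 < c) → c * g ≡ g
    by-quotient (tri≈ _ refl _) = ℤP.*-identityˡ g
    by-quotient (tri< c<1 _ _) =
      ⊥-elim (0≰-[1+n] (0≤-cong negative (0≤-+ (0≤-* (<⇒0≤-1 c<1) 0≤g) (≤⇒0≤- 1≤cg))))
      where
      negative : (+ 1 - c - + 1) * g + (c * g - + 1) ≡ - + 1
      negative = solve (c ∷ g ∷ [])
    by-quotient (tri> _ _ 1<c) =
      ⊥-elim (0≰-[1+n] (0≤-cong negative
        (0≤-+ (0≤-+ (0≤-* (<⇒0≤-1 1<c) 0≤g) (≤⇒0≤- cg≤g)) (≤⇒0≤- 1≤g))))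
      where
      negative : (c - + 1 - + 1) * g + (g - c * g) + (g - + 1) ≡ - + 1
      negative = solve (c ∷ g ∷ [])

  coprime-divisorₛ : ∀ i j k → Coprime i j → i ∣ j * k → i ∣ k
  coprime-divisorₛ i j k i⊥j i∣jk = ∣ᵤ⇒∣ (coprime-divisor i j k i⊥j (∣⇒∣ᵤ i∣jk))

  shift-difference : ∀ {q₁ q₂ b c t N₁ N₂} →
    q₂ ≡ q₁ + b → q₁ + c ≡ t * N₁ → q₂ + c ≡ t * N₂ → b ≡ t * (N₂ - N₁)
  shift-difference {q₁} {b = b} {c} {t} {N₁} {N₂} refl e₁ e₂ = begin
    b                         ≡⟨ solve (q₁ ∷ b ∷ c ∷ []) ⟩
    (q₁ + b + c) - (q₁ + c)   ≡⟨ cong₂ _-_ e₂ e₁ ⟩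
    t * N₂ - t * N₁           ≡⟨ solve (t ∷ N₁ ∷ N₂ ∷ []) ⟩
    t * (N₂ - N₁)             ∎
    where open ≡-Reasoning

  value-step : ∀ {q q′ c t N₀ κ} → q + c ≡ t * N₀ → q′ + c ≡ t * (N₀ + κ) → q′ ≡ q + t * κ
  value-step {q} {q′} {c} {t} {N₀} {κ} e e′ = begin
    q′                  ≡⟨ solve (q′ ∷ c ∷ []) ⟩
    (q′ + c) - c        ≡⟨ cong (_- c) e′ ⟩
    t * (N₀ + κ) - c    ≡⟨ solve (t ∷ N₀ ∷ κ ∷ c ∷ []) ⟩
    t * N₀ - c + t * κ  ≡⟨ cong (λ z → z - c + t * κ) e ⟨
    q + c - c + t * κ   ≡⟨ solve (q ∷ c ∷ t ∷ κ ∷ []) ⟩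
    q + t * κ           ∎
    where open ≡-Reasoning

  zero-quotient : ∀ d F R → - F < R → R < F → d * F + R ≡ 0ℤ → d ≡ 0ℤ
  zero-quotient d F R -F<R R<F dF+R≡0 = by-sign (ℤP.<-cmp d 0ℤ)
    where
    open ≡-Reasoning
    0≤2F : 0ℤ ≤ + 2 * F
    0≤2F = 0≤-cong 2F≡ (0≤-+ (0≤-+ (<⇒0≤-1 R<F) (<⇒0≤-1 -F<R)) (0≤+ 2))
      where
      2F≡ : (F - R - + 1) + (R - - F - + 1) + + 2 ≡ + 2 * F
      2F≡ = solve (F ∷ R ∷ [])
    by-sign : Tri (d < 0ℤ) (d ≡ 0ℤ) (0ℤ < d) → d ≡ 0ℤ
    by-sign (tri≈ _ d≡0 _) = d≡0
    by-sign (tri< d<0 _ _) = ⊥-elim (0≰-[1+n] (0≤-cong negative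
      (0≤-+ (0≤-* (<⇒0≤-1 d<0) 0≤2F) (0≤-* (0≤+ 2) (<⇒0≤-1 R<F)))))
      where
      negative : (0ℤ - d - + 1) * (+ 2 * F) + + 2 * (F - R - + 1) ≡ - + 2
      negative = begin
        (0ℤ - d - + 1) * (+ 2 * F) + + 2 * (F - R - + 1) ≡⟨ solve (d ∷ F ∷ R ∷ []) ⟩
        - + 2 * (d * F + R) - + 2                        ≡⟨ cong (λ z → - + 2 * z - + 2) dF+R≡0 ⟩
        - + 2                                            ∎
    by-sign (tri> _ _ d>0) = ⊥-elim (0≰-[1+n] (0≤-cong negative
      (0≤-+ (0≤-* (<⇒0≤-1 d>0) 0≤2F) (0≤-* (0≤+ 2) (<⇒0≤-1 -F<R)))))
      where
      negative : (d - 0ℤ - + 1) * (+ 2 * F) + + 2 * (R - - F - + 1) ≡ - + 2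
      negative = begin
        (d - 0ℤ - + 1) * (+ 2 * F) + + 2 * (R - - F - + 1) ≡⟨ solve (d ∷ F ∷ R ∷ []) ⟩
        + 2 * (d * F + R) - + 2                            ≡⟨ cong (λ z → + 2 * z - + 2) dF+R≡0 ⟩
        - + 2                                              ∎

  step-factorisation : ∀ w w′ t y′ α κ G →
    w′ * w′ + α * w′ + + 2 * κ * y′ ≡ w * w + α * w + + 2 * κ * t + + 2 * κ * G →
    (w′ - w - κ) * (w + w′ + κ + α) + κ * (κ + α + + 2 * (w - t + y′) - + 2 * G) ≡ 0ℤ
  step-factorisation w w′ t y′ α κ G step = begin
    (w′ - w - κ) * (w + w′ + κ + α) + κ * (κ + α + + 2 * (w - t + y′) - + 2 * G)
      ≡⟨ solve (w ∷ w′ ∷ t ∷ y′ ∷ α ∷ κ ∷ G ∷ []) ⟩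
    (w′ * w′ + α * w′ + + 2 * κ * y′) - (w * w + α * w + + 2 * κ * t + + 2 * κ * G)
      ≡⟨ cong (_- (w * w + α * w + + 2 * κ * t + + 2 * κ * G)) step ⟩
    (w * w + α * w + + 2 * κ * t + + 2 * κ * G) - (w * w + α * w + + 2 * κ * t + + 2 * κ * G)
      ≡⟨ ℤP.+-inverseʳ (w * w + α * w + + 2 * κ * t + + 2 * κ * G) ⟩
    0ℤ ∎
    where open ≡-Reasoning

  step-remainder-bounds : ∀ {w w′ t y′ α κ G A} →
    0ℤ ≤ κ → α ≤ A → - A ≤ α → 0ℤ ≤ y′ → y′ ≤ w′ → t ≤ w → w - t < G → y′ < G →
    κ * (κ + A + + 2 * G) + A < w →
    - (w + w′ + κ + α) < κ * (κ + α + + 2 * (w - t + y′) - + 2 * G)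
    × κ * (κ + α + + 2 * (w - t + y′) - + 2 * G) < w + w′ + κ + α
  step-remainder-bounds {w} {w′} {t} {y′} {α} {κ} {G} {A}
                        0≤κ α≤A -A≤α 0≤y′ y′≤w′ t≤w w-t<G y′<G big =
    0≤-1⇒< (0≤-cong F+R≡ (0≤-+ common
      (0≤-* 0≤κ (0≤-+ (0≤-+ (0≤-+ (0≤-* (0≤+ 2) 0≤κ) (≤⇒0≤- -A≤α)) (0≤-* (0≤+ 2) (≤⇒0≤- t≤w)))
                       (0≤-* (0≤+ 2) 0≤y′)))))
    , 0≤-1⇒< (0≤-cong F-R≡ (0≤-+ common
      (0≤-* 0≤κ (0≤-+ (0≤-+ (0≤-+ (≤⇒0≤- α≤A) (0≤-* (0≤+ 2) (<⇒0≤-1 w-t<G)))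
                                (0≤-* (0≤+ 2) (<⇒0≤-1 y′<G))) (0≤+ 4)))))
    where
    common : 0ℤ ≤ (w - (κ * (κ + A + + 2 * G) + A) - + 1) + w′ + κ + (α - - A)
    common = 0≤-+ (0≤-+ (0≤-+ (<⇒0≤-1 big) (ℤP.≤-trans 0≤y′ y′≤w′)) 0≤κ) (≤⇒0≤- -A≤α)
    F+R≡ : (w - (κ * (κ + A + + 2 * G) + A) - + 1) + w′ + κ + (α - - A)
             + κ * (+ 2 * κ + (α - - A) + + 2 * (w - t) + + 2 * y′)
         ≡ κ * (κ + α + + 2 * (w - t + y′) - + 2 * G) - - (w + w′ + κ + α) - + 1
    F+R≡ = solve (w ∷ w′ ∷ t ∷ y′ ∷ α ∷ κ ∷ G ∷ A ∷ [])
    F-R≡ : (w - (κ * (κ + A + + 2 * G) + A) - + 1) + w′ + κ + (α - - A)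
             + κ * ((A - α) + + 2 * (G - (w - t) - + 1) + + 2 * (G - y′ - + 1) + + 4)
         ≡ (w + w′ + κ + α) - κ * (κ + α + + 2 * (w - t + y′) - + 2 * G) - + 1
    F-R≡ = solve (w ∷ w′ ∷ t ∷ y′ ∷ α ∷ κ ∷ G ∷ A ∷ [])

  -- The two sides differ by (w′ − w − κ) F + R with ∣R∣ < F, so w′ = w + κ, and then R = 0.
  quadratic-step : ∀ {w w′ t y′ α κ G A} →
    + 1 ≤ κ → α ≤ A → - A ≤ α → 0ℤ ≤ y′ → y′ ≤ w′ → t ≤ w → w - t < G → y′ < G →
    κ * (κ + A + + 2 * G) + A < w →
    w′ * w′ + α * w′ + + 2 * κ * y′ ≡ w * w + α * w + + 2 * κ * t + + 2 * κ * G →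
    w′ ≡ w + κ × + 2 * (w - t + y′) + α + κ ≡ + 2 * G
  quadratic-step {w} {w′} {t} {y′} {α} {κ} {G} {A} 1≤κ α≤A -A≤α 0≤y′ y′≤w′ t≤w w-t<G y′<G big step =
    w′≡w+κ , from-factor (ℤP.i*j≡0⇒i≡0∨j≡0 κ R≡0)
    where
    open ≡-Reasoning
    dF+R≡0 : (w′ - w - κ) * (w + w′ + κ + α) + κ * (κ + α + + 2 * (w - t + y′) - + 2 * G) ≡ 0ℤ
    dF+R≡0 = step-factorisation w w′ t y′ α κ G step

    d≡0 : w′ - w - κ ≡ 0ℤ
    d≡0 =
      let -F<R , R<F =
            step-remainder-bounds (ℤP.≤-trans (0≤+ 1) 1≤κ) α≤A -A≤α 0≤y′ y′≤w′ t≤w w-t<G y′<G big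
      in zero-quotient (w′ - w - κ) _ _ -F<R R<F dF+R≡0

    w′≡w+κ : w′ ≡ w + κ
    w′≡w+κ = begin
      w′                      ≡⟨ solve (w ∷ w′ ∷ κ ∷ []) ⟩
      (w′ - w - κ) + (w + κ)  ≡⟨ cong (_+ (w + κ)) d≡0 ⟩
      0ℤ + (w + κ)            ≡⟨ ℤP.+-identityˡ (w + κ) ⟩
      w + κ                   ∎

    R≡0 : κ * (κ + α + + 2 * (w - t + y′) - + 2 * G) ≡ 0ℤ
    R≡0 = trans (sym (ℤP.+-identityˡ _))
      (trans (cong (λ d → d * (w + w′ + κ + α) + κ * (κ + α + + 2 * (w - t + y′) - + 2 * G)) (sym d≡0)) dF+R≡0)

    from-factor : κ ≡ 0ℤ ⊎ κ + α + + 2 * (w - t + y′) - + 2 * G ≡ 0ℤ →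
                  + 2 * (w - t + y′) + α + κ ≡ + 2 * G
    from-factor (inj₁ κ≡0) = ⊥-elim (ℤP.<-irrefl (sym κ≡0) (ℤP.<-≤-trans (+<+ (ℕ.s≤s z≤n)) 1≤κ))
    from-factor (inj₂ X≡0) = begin
      + 2 * (w - t + y′) + α + κ                         ≡⟨ solve (w ∷ t ∷ y′ ∷ α ∷ κ ∷ G ∷ []) ⟩
      (κ + α + + 2 * (w - t + y′) - + 2 * G) + + 2 * G   ≡⟨ cong (_+ + 2 * G) X≡0 ⟩
      0ℤ + + 2 * G                                       ≡⟨ ℤP.+-identityˡ (+ 2 * G) ⟩
      + 2 * G                                            ∎

open IntegerArithmetic

module Wedge (l g ρ : ℤ) where
  open import Data.Integer using (_+_; _*_; _-_; -_; _≤_; _<_)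
  open import Data.Integer.Divisibility.Signed
    using (_∣_; divides; module ∣-Reasoning; ∣m∣n⇒∣m+n; ∣m∣n⇒∣m-n; ∣-reflexive)
  open ℤ-RingSolver using (solve)

  W : Point → ℤ
  W (x , y) = l * (g * x - ρ * y)

  InWedge : Point → Set
  InWedge (x , y) = 0ℤ ≤ y × y ≤ W (x , y)

  Q : ℤ → ℤ → Point → ℤ
  Q α β (x , y) = W (x , y) * W (x , y) + α * W (x , y) + β * y

  shift : Point → Point
  shift (x , y) = x + ρ , y + g

  W-shift : ∀ p → W (shift p) ≡ W p
  W-shift (x , y) = begin
    l * (g * (x + ρ) - ρ * (y + g)) ≡⟨ solve (x ∷ y ∷ l ∷ g ∷ ρ ∷ []) ⟩
    l * (g * x - ρ * y)             ∎
    where open ≡-Reasoning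

  Q-shift : ∀ α β p → Q α β (shift p) ≡ Q α β p + β * g
  Q-shift α β p@(x , y) = begin
    W (shift p) * W (shift p) + α * W (shift p) + β * (y + g)
      ≡⟨ cong (λ w → w * w + α * w + β * (y + g)) (W-shift p) ⟩
    W p * W p + α * W p + β * (y + g) ≡⟨ expand (W p) ⟩
    W p * W p + α * W p + β * y + β * g ∎
    where
    open ≡-Reasoning
    expand : ∀ w → w * w + α * w + β * (y + g) ≡ w * w + α * w + β * y + β * g
    expand w = solve (w ∷ α ∷ β ∷ y ∷ g ∷ [])

  module PackingArgument
    (α K : ℤ) (1≤l : + 1 ≤ l) (1≤g : + 1 ≤ g) (0≤ρ : 0ℤ ≤ ρ) (1≤K : + 1 ≤ K) (g⊥ρ : Coprime g ρ)
    (successor : ∀ {p} → InWedge p →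
       ∃ λ p′ → InWedge p′ × Q α (+ 2 * (K * l)) p′ ≡ Q α (+ 2 * (K * l)) p + + 2 * (K * l) * g)
    (injective : ∀ {p p′} → InWedge p → InWedge p′ →
       Q α (+ 2 * (K * l)) p ≡ Q α (+ 2 * (K * l)) p′ → p ≡ p′)
    where

    Qᴷ : Point → ℤ
    Qᴷ = Q α (+ 2 * (K * l))

    0≤g : 0ℤ ≤ g
    0≤g = ℤP.≤-trans (0≤+ 1) 1≤g

    0≤l : 0ℤ ≤ l
    0≤l = ℤP.≤-trans (0≤+ 1) 1≤l

    1≤Kl : + 1 ≤ K * l
    1≤Kl = 1≤-* 1≤K 1≤l

    1≤lg : + 1 ≤ l * g
    1≤lg = 1≤-* 1≤l 1≤g

    cancel-l : ∀ {a b} → l * a ≡ l * b → a ≡ b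
    cancel-l {a} {b} = ℤP.*-cancelˡ-≡ l a b
      where instance
        l≢0 : ℤ.NonZero l
        l≢0 = ℤ.>-nonZero (ℤP.<-≤-trans (+<+ (ℕ.s≤s z≤n)) 1≤l)

    -- If y′ ≥ g, then (x′ − ρ, y′ − g) is in the wedge with the value of (x, t), so it is
    -- (x, t) by injectivity, and the gap above (x, t) is at least g.
    successor-low : ∀ {x t x′ y′} → InWedge (x , t) → W (x , t) - t < g → InWedge (x′ , y′) →
                    Qᴷ (x′ , y′) ≡ Qᴷ (x , t) + + 2 * (K * l) * g → y′ < g
    successor-low {x} {t} {x′} {y′} p∈ gap<g (_ , y′≤W′) step = ℤP.≰⇒> below
      where
      q : Point
      q = x′ - ρ , y′ - g
      shift-q : shift q ≡ (x′ , y′)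
      shift-q = cong₂ _,_ (i-j+j≡i x′ ρ) (i-j+j≡i y′ g)
      W-q : W q ≡ W (x′ , y′)
      W-q = trans (sym (W-shift q)) (cong W shift-q)
      below : ¬ (g ≤ y′)
      below g≤y′ = y≤w⇒w-[y-g]≮g y′≤W′
        (subst (λ w → w - (y′ - g) < g) W-q (subst (λ p → W p - proj₂ p < g) (sym q≡p) gap<g))
        where
        q∈ : InWedge q
        q∈ = ≤⇒0≤- g≤y′ , subst (y′ - g ≤_) (sym W-q) (i≤j⇒i-k≤j 0≤g y′≤W′)
        q≡p : q ≡ (x , t)
        q≡p = injective q∈ p∈
          (+-cancelʳ (+ 2 * (K * l) * g) (trans (sym (Q-shift α (+ 2 * (K * l)) q)) (trans (cong Qᴷ shift-q) step)))

    successor-congruence : ∀ {x t x′ y′} → W (x′ , y′) ≡ W (x , t) + K * l → g ∣ K + ρ * (y′ - t)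
    successor-congruence {x} {t} {x′} {y′} W′≡W+Kl = divides (x′ - x) (begin
      K + ρ * (y′ - t)
        ≡⟨ solve (K ∷ g ∷ ρ ∷ x ∷ t ∷ x′ ∷ y′ ∷ []) ⟩
      (g * x - ρ * t + K) - (g * x′ - ρ * y′) + (x′ - x) * g
        ≡⟨ cong (λ z → (g * x - ρ * t + K) - z + (x′ - x) * g) cancelled ⟩
      (g * x - ρ * t + K) - (g * x - ρ * t + K) + (x′ - x) * g
        ≡⟨ solve (K ∷ g ∷ ρ ∷ x ∷ t ∷ x′ ∷ []) ⟩
      (x′ - x) * g ∎)
      where
      open ≡-Reasoning
      factor : l * (g * x - ρ * t) + K * l ≡ l * (g * x - ρ * t + K)
      factor = solve (l ∷ g ∷ ρ ∷ x ∷ t ∷ K ∷ [])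
      cancelled : g * x′ - ρ * y′ ≡ g * x - ρ * t + K
      cancelled = cancel-l (trans W′≡W+Kl factor)

    A : ℤ
    A = + ℤ.∣ α ∣

    bound : ℤ
    bound = K * l * (K * l + A + + 2 * g) + A

    0≤bound : 0ℤ ≤ bound
    0≤bound = 0≤-+ (0≤-* 0≤Kl (0≤-+ (0≤-+ 0≤Kl (0≤+ _)) (0≤-* (0≤+ 2) 0≤g))) (0≤+ _)
      where
      0≤Kl : 0ℤ ≤ K * l
      0≤Kl = ℤP.≤-trans (0≤+ 1) 1≤Kl

    top-successor : ∀ {x t} → InWedge (x , t) → W (x , t) - t < g → bound < W (x , t) →
      ∃ λ y′ → 0ℤ ≤ y′ × y′ < g × g ∣ K + ρ * (y′ - t)
             × + 2 * (W (x , t) - t + y′) + α + K * l ≡ + 2 * g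
    top-successor p∈@(_ , t≤W) gap<g big =
      let (_ , y′) , p′∈@(0≤y′ , y′≤W′) , step = successor p∈
          y′<g = successor-low p∈ gap<g p′∈ step
          α≤A , -A≤α = ∣i∣-bounds α
          W′≡W+Kl , balance = quadratic-step 1≤Kl α≤A -A≤α 0≤y′ y′≤W′ t≤W gap<g y′<g big step
      in y′ , 0≤y′ , y′<g , successor-congruence W′≡W+Kl , balance

    column-A : ∀ S → 0ℤ ≤ S → bound < S →
      ∃ λ yA → yA < g × g ∣ K + ρ * yA × + 2 * yA + α + K * l ≡ + 2 * g
    column-A S 0≤S bound<S =
      let yA , _ , yA<g , g∣K+ρ[yA-t] , balance = top-successor p∈ gap<g big
      in yA , yA<g , g∣K+ρyA g∣K+ρ[yA-t] , trans (cong (λ e → + 2 * e + α + K * l) (sym (zero-gap yA))) balance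
      where
      p : Point
      p = (l * ρ + + 1) * S , l * g * S
      W-p : W p ≡ l * g * S
      W-p = begin
        l * (g * ((l * ρ + + 1) * S) - ρ * (l * g * S)) ≡⟨ solve (l ∷ g ∷ ρ ∷ S ∷ []) ⟩
        l * g * S                                       ∎
        where open ≡-Reasoning
      p∈ : InWedge p
      p∈ = 0≤-* (0≤-* 0≤l 0≤g) 0≤S , ℤP.≤-reflexive (sym W-p)
      zero-gap : ∀ y → W p - l * g * S + y ≡ y
      zero-gap y = trans (cong (λ w → w - l * g * S + y) W-p) (solve (l ∷ g ∷ S ∷ y ∷ []))
      gap<g : W p - l * g * S < g
      gap<g = subst (_< g) (sym (trans (sym (ℤP.+-identityʳ _)) (zero-gap 0ℤ)))
                (ℤP.<-≤-trans (+<+ (ℕ.s≤s z≤n)) 1≤g)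
      big : bound < W p
      big = subst (bound <_) (sym W-p) (ℤP.<-≤-trans bound<S (i≤j*i 1≤lg 0≤S))
      g∣K+ρyA : ∀ {y} → g ∣ K + ρ * (y - l * g * S) → g ∣ K + ρ * y
      g∣K+ρyA {y} g∣K+ρ[y-t] = begin
        g                                             ∣⟨ ∣m∣n⇒∣m+n g∣K+ρ[y-t] (divides (ρ * l * S) refl) ⟩
        K + ρ * (y - l * g * S) + ρ * l * S * g       ≡⟨ solve (K ∷ ρ ∷ y ∷ l ∷ g ∷ S ∷ []) ⟩
        K + ρ * y                                     ∎
        where open ∣-Reasoning

    column-B : ∀ s → 0ℤ ≤ s → bound + l * ρ < s →
      ∃₂ λ yB r → 0ℤ ≤ yB × 0ℤ ≤ r × g ∣ r + + 1 + l * ρ × g ∣ K + ρ * yB - ρ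
                × + 2 * (r + yB) + α + K * l ≡ + 2 * g
    column-B s 0≤s bound+lρ<s = at-division (nonNeg-divMod (l * g * s - l * ρ - + 1) g 0≤w-1 1≤g)
      where
      bound<w : bound < l * g * s - l * ρ
      bound<w = b+c<s⇒b<a*s-c 1≤lg 0≤s bound+lρ<s
      0≤w-1 : 0ℤ ≤ l * g * s - l * ρ - + 1
      0≤w-1 = ≤⇒0≤- (ℤP.≤-trans (ℤP.+-monoʳ-≤ (+ 1) 0≤bound) (ℤP.i<j⇒suc[i]≤j bound<w))
      at-division : (∃₂ λ j r → l * g * s - l * ρ - + 1 ≡ r + j * g × 0ℤ ≤ j × 0ℤ ≤ r × r < g) →
        ∃₂ λ yB r → 0ℤ ≤ yB × 0ℤ ≤ r × g ∣ r + + 1 + l * ρ × g ∣ K + ρ * yB - ρ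
                  × + 2 * (r + yB) + α + K * l ≡ + 2 * g
      at-division (j , r , w-1≡ , 0≤j , 0≤r , r<g) =
        let yB , 0≤yB , _ , g∣K+ρ[yB-t] , balance = top-successor p∈ (subst (_< g) (sym gap≡r) r<g) big
        in yB , r , 0≤yB , 0≤r , g∣r+1+lρ , g∣K+ρyB-ρ g∣K+ρ[yB-t]
         , trans (cong (λ e → + 2 * (e + yB) + α + K * l) (sym gap≡r)) balance
        where
        p : Point
        p = s + ρ * j , + 1 + g * j
        W-p : W p ≡ l * g * s - l * ρ
        W-p = begin
          l * (g * (s + ρ * j) - ρ * (+ 1 + g * j)) ≡⟨ solve (l ∷ g ∷ ρ ∷ s ∷ j ∷ []) ⟩
          l * g * s - l * ρ                         ∎
          where open ≡-Reasoning
        gap≡r : W p - (+ 1 + g * j) ≡ r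
        gap≡r = begin
          W p - (+ 1 + g * j)                   ≡⟨ cong (_- (+ 1 + g * j)) W-p ⟩
          l * g * s - l * ρ - (+ 1 + g * j)     ≡⟨ solve (l ∷ g ∷ ρ ∷ s ∷ j ∷ []) ⟩
          (l * g * s - l * ρ - + 1) - j * g     ≡⟨ cong (_- j * g) w-1≡ ⟩
          r + j * g - j * g                     ≡⟨ solve (r ∷ j ∷ g ∷ []) ⟩
          r                                     ∎
          where open ≡-Reasoning
        p∈ : InWedge p
        p∈ = 0≤-+ (0≤+ 1) (0≤-* 0≤g 0≤j) , 0≤-⇒≤ (subst (0ℤ ≤_) (sym gap≡r) 0≤r)
        big : bound < W p
        big = subst (bound <_) (sym W-p) bound<w
        g∣r+1+lρ : g ∣ r + + 1 + l * ρ
        g∣r+1+lρ = divides (l * s - j) (begin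
          r + + 1 + l * ρ                                 ≡⟨ solve (r ∷ j ∷ g ∷ l ∷ ρ ∷ []) ⟩
          r + j * g - j * g + + 1 + l * ρ                 ≡⟨ cong (λ z → z - j * g + + 1 + l * ρ) w-1≡ ⟨
          l * g * s - l * ρ - + 1 - j * g + + 1 + l * ρ   ≡⟨ solve (l ∷ g ∷ ρ ∷ s ∷ j ∷ []) ⟩
          (l * s - j) * g                                 ∎)
          where open ≡-Reasoning
        g∣K+ρyB-ρ : ∀ {y} → g ∣ K + ρ * (y - (+ 1 + g * j)) → g ∣ K + ρ * y - ρ
        g∣K+ρyB-ρ {y} g∣K+ρ[y-t] = begin
          g                                               ∣⟨ ∣m∣n⇒∣m+n g∣K+ρ[y-t] (divides (ρ * j) refl) ⟩
          K + ρ * (y - (+ 1 + g * j)) + ρ * j * g         ≡⟨ solve (K ∷ ρ ∷ y ∷ g ∷ j ∷ []) ⟩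
          K + ρ * y - ρ                                   ∎
          where open ∣-Reasoning

    column-comparison : ∀ {yA yB r} → yA < g → 0ℤ ≤ yB → 0ℤ ≤ r →
      g ∣ K + ρ * yA → + 2 * yA + α + K * l ≡ + 2 * g →
      g ∣ r + + 1 + l * ρ → g ∣ K + ρ * yB - ρ → + 2 * (r + yB) + α + K * l ≡ + 2 * g →
      α ≡ + 2 - K * l × g ∣ l × g ∣ K - ρ
    column-comparison {yA} {yB} {r} yA<g 0≤yB 0≤r g∣K+ρyA balanceA g∣r+1+lρ g∣K+ρyB-ρ balanceB =
      α≡2-Kl , g∣l , g∣K-ρ
      where
      yA≡r+yB : yA ≡ r + yB
      yA≡r+yB = ℤP.*-cancelˡ-≡ (+ 2) yA (r + yB) (+-cancelʳ α (+-cancelʳ (K * l) (trans balanceA (sym balanceB))))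

      g∣r+1 : g ∣ r + + 1
      g∣r+1 = coprime-divisorₛ g ρ (r + + 1) g⊥ρ (begin
        g                                       ∣⟨ ∣m∣n⇒∣m-n g∣K+ρyA g∣K+ρyB-ρ ⟩
        (K + ρ * yA) - (K + ρ * yB - ρ)         ≡⟨ cong (λ y → (K + ρ * y) - (K + ρ * yB - ρ)) yA≡r+yB ⟩
        (K + ρ * (r + yB)) - (K + ρ * yB - ρ)   ≡⟨ solve (K ∷ ρ ∷ r ∷ yB ∷ []) ⟩
        ρ * (r + + 1)                           ∎)
        where open ∣-Reasoning

      r+1≡g : r + + 1 ≡ g
      r+1≡g = ∣∧0<∧≤⇒≡ g∣r+1 (ℤP.+-monoˡ-≤ (+ 1) 0≤r)
        (0≤-⇒≤ (0≤-cong eq (0≤-+ (<⇒0≤-1 (subst (_< g) yA≡r+yB yA<g)) 0≤yB)))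
        where
        eq : (g - (r + yB) - + 1) + yB ≡ g - (r + + 1)
        eq = solve (g ∷ r ∷ yB ∷ [])

      yA≡g-1 : yA ≡ g - + 1
      yA≡g-1 = ℤP.≤-antisym (0≤-⇒≤ (0≤-cong eq₁ (<⇒0≤-1 yA<g))) (0≤-⇒≤ (0≤-cong eq₂ 0≤yB))
        where
        eq₁ : g - yA - + 1 ≡ g - + 1 - yA
        eq₁ = solve (g ∷ yA ∷ [])
        eq₂ : yB ≡ yA - (g - + 1)
        eq₂ = begin
          yB                         ≡⟨ solve (r ∷ yB ∷ []) ⟩
          r + yB - (r + + 1 - + 1)   ≡⟨ cong₂ (λ y z → y - (z - + 1)) (sym yA≡r+yB) r+1≡g ⟩
          yA - (g - + 1)             ∎
          where open ≡-Reasoning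

      α≡2-Kl : α ≡ + 2 - K * l
      α≡2-Kl = begin
        α                                            ≡⟨ solve (α ∷ yA ∷ K ∷ l ∷ []) ⟩
        (+ 2 * yA + α + K * l) - + 2 * yA - K * l    ≡⟨ cong₂ (λ b y → b - + 2 * y - K * l) balanceA yA≡g-1 ⟩
        + 2 * g - + 2 * (g - + 1) - K * l            ≡⟨ solve (g ∷ K ∷ l ∷ []) ⟩
        + 2 - K * l                                  ∎
        where open ≡-Reasoning

      g∣l : g ∣ l
      g∣l = coprime-divisorₛ g ρ l g⊥ρ (begin
        g                              ∣⟨ ∣m∣n⇒∣m-n g∣r+1+lρ (∣-reflexive (sym r+1≡g)) ⟩
        r + + 1 + l * ρ - (r + + 1)    ≡⟨ solve (r ∷ l ∷ ρ ∷ []) ⟩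
        ρ * l                          ∎)
        where open ∣-Reasoning

      g∣K-ρ : g ∣ K - ρ
      g∣K-ρ = begin
        g                           ∣⟨ ∣m∣n⇒∣m-n g∣K+ρyA (divides ρ refl) ⟩
        K + ρ * yA - ρ * g          ≡⟨ cong (λ y → K + ρ * y - ρ * g) yA≡g-1 ⟩
        K + ρ * (g - + 1) - ρ * g   ≡⟨ solve (K ∷ ρ ∷ g ∷ []) ⟩
        K - ρ                       ∎
        where open ∣-Reasoning

    conclusion : α ≡ + 2 - K * l × g ∣ l × g ∣ K - ρ
    conclusion =
      let yA , yA<g , g∣K+ρyA , balanceA = column-A (bound + + 1) 0≤S (i<i+1 bound)
          yB , r , 0≤yB , 0≤r , g∣r+1+lρ , g∣K+ρyB-ρ , balanceB =
            column-B (bound + l * ρ + + 1) 0≤s (i<i+1 (bound + l * ρ))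
      in column-comparison yA<g 0≤yB 0≤r g∣K+ρyA balanceA g∣r+1+lρ g∣K+ρyB-ρ balanceB
      where
      0≤S : 0ℤ ≤ bound + + 1
      0≤S = 0≤-+ 0≤bound (0≤+ 1)
      0≤s : 0ℤ ≤ bound + l * ρ + + 1
      0≤s = 0≤-+ (0≤-+ 0≤bound (0≤-* 0≤l 0≤ρ)) (0≤+ 1)

module IntegerEmbedding where
  open import Data.Rational using (_+_; _*_; -_; _-_; _≤_; _<_)

  fromℚᵘ-homo-+ : ∀ p q → ℚ.fromℚᵘ (p ℚᵘ.+ q) ≡ ℚ.fromℚᵘ p + ℚ.fromℚᵘ q
  fromℚᵘ-homo-+ p q = ℚP.toℚᵘ-injective (ℚᵘP.≃-trans (ℚP.toℚᵘ-fromℚᵘ (p ℚᵘ.+ q))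
    (ℚᵘP.≃-trans (ℚᵘP.+-cong (ℚᵘP.≃-sym (ℚP.toℚᵘ-fromℚᵘ p)) (ℚᵘP.≃-sym (ℚP.toℚᵘ-fromℚᵘ q)))
      (ℚᵘP.≃-sym (ℚP.toℚᵘ-homo-+ (ℚ.fromℚᵘ p) (ℚ.fromℚᵘ q)))))

  fromℚᵘ-homo-* : ∀ p q → ℚ.fromℚᵘ (p ℚᵘ.* q) ≡ ℚ.fromℚᵘ p * ℚ.fromℚᵘ q
  fromℚᵘ-homo-* p q = ℚP.toℚᵘ-injective (ℚᵘP.≃-trans (ℚP.toℚᵘ-fromℚᵘ (p ℚᵘ.* q))
    (ℚᵘP.≃-trans (ℚᵘP.*-cong (ℚᵘP.≃-sym (ℚP.toℚᵘ-fromℚᵘ p)) (ℚᵘP.≃-sym (ℚP.toℚᵘ-fromℚᵘ q)))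
      (ℚᵘP.≃-sym (ℚP.toℚᵘ-homo-* (ℚ.fromℚᵘ p) (ℚ.fromℚᵘ q)))))

  fromℚᵘ-homo‿- : ∀ p → ℚ.fromℚᵘ (ℚᵘ.- p) ≡ - ℚ.fromℚᵘ p
  fromℚᵘ-homo‿- p = ℚP.toℚᵘ-injective (ℚᵘP.≃-trans (ℚP.toℚᵘ-fromℚᵘ (ℚᵘ.- p))
    (ℚᵘP.≃-trans (ℚᵘP.-‿cong (ℚᵘP.≃-sym (ℚP.toℚᵘ-fromℚᵘ p)))
      (ℚᵘP.≃-sym (ℚP.toℚᵘ-homo‿- (ℚ.fromℚᵘ p)))))

  ℤ→ℚ-homo-+ : ∀ a b → ℤ→ℚ (a ℤ.+ b) ≡ ℤ→ℚ a + ℤ→ℚ b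
  ℤ→ℚ-homo-+ a b = trans
    (ℚP.fromℚᵘ-cong {ℚᵘ.mkℚᵘ (a ℤ.+ b) 0} {ℚᵘ.mkℚᵘ a 0 ℚᵘ.+ ℚᵘ.mkℚᵘ b 0} (ℚᵘ.*≡* (cross-multiplied a b)))
    (fromℚᵘ-homo-+ (ℚᵘ.mkℚᵘ a 0) (ℚᵘ.mkℚᵘ b 0))
    where
    cross-multiplied : ∀ a b → (a ℤ.+ b) ℤ.* + 1 ≡ (a ℤ.* + 1 ℤ.+ b ℤ.* + 1) ℤ.* + 1
    cross-multiplied = ℤ-RingSolver.solve-∀

  ℤ→ℚ-homo-* : ∀ a b → ℤ→ℚ (a ℤ.* b) ≡ ℤ→ℚ a * ℤ→ℚ b
  ℤ→ℚ-homo-* a b = fromℚᵘ-homo-* (ℚᵘ.mkℚᵘ a 0) (ℚᵘ.mkℚᵘ b 0)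

  ℤ→ℚ-homo‿- : ∀ a → ℤ→ℚ (ℤ.- a) ≡ - ℤ→ℚ a
  ℤ→ℚ-homo‿- a = fromℚᵘ-homo‿- (ℚᵘ.mkℚᵘ a 0)

  ℤ→ℚ-homo-− : ∀ a b → ℤ→ℚ (a ℤ.- b) ≡ ℤ→ℚ a - ℤ→ℚ b
  ℤ→ℚ-homo-− a b = trans (ℤ→ℚ-homo-+ a (ℤ.- b)) (cong (λ z → ℤ→ℚ a + z) (ℤ→ℚ-homo‿- b))

  /-as-* : ∀ a d .{{_ : NonZero d}} → a / d ≡ ℤ→ℚ a * ((+ 1) / d)
  /-as-* a (ℕ.suc d-1) = trans
    (ℚP.fromℚᵘ-cong {ℚᵘ.mkℚᵘ a d-1} {ℚᵘ.mkℚᵘ a 0 ℚᵘ.* ℚᵘ.mkℚᵘ (+ 1) d-1} (ℚᵘ.*≡* same))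
    (fromℚᵘ-homo-* (ℚᵘ.mkℚᵘ a 0) (ℚᵘ.mkℚᵘ (+ 1) d-1))
    where
    same : a ℤ.* + ℕ.suc (d-1 ℕ.+ 0) ≡ (a ℤ.* + 1) ℤ.* + ℕ.suc d-1
    same = trans (cong (λ k → a ℤ.* + ℕ.suc k) (ℕP.+-identityʳ d-1))
                 (cong (ℤ._* + ℕ.suc d-1) (sym (ℤP.*-identityʳ a)))

  d*[1/d]≡1 : ∀ d .{{_ : NonZero d}} → ℤ→ℚ (+ d) * ((+ 1) / d) ≡ 1ℚ
  d*[1/d]≡1 d@(ℕ.suc d-1) = trans (sym (fromℚᵘ-homo-* (ℚᵘ.mkℚᵘ (+ d) 0) (ℚᵘ.mkℚᵘ (+ 1) d-1)))
    (ℚP.fromℚᵘ-cong {ℚᵘ.mkℚᵘ (+ d) 0 ℚᵘ.* ℚᵘ.mkℚᵘ (+ 1) d-1} {ℚᵘ.mkℚᵘ (+ 1) 0} (ℚᵘ.*≡* same))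
    where
    same : (+ d ℤ.* + 1) ℤ.* + 1 ≡ + 1 ℤ.* + ℕ.suc (d-1 ℕ.+ 0)
    same = trans (ℤP.*-identityʳ (+ d ℤ.* + 1)) (trans (ℤP.*-identityʳ (+ d))
             (sym (trans (ℤP.*-identityˡ _) (cong (λ k → + ℕ.suc k) (ℕP.+-identityʳ d-1)))))

  d*[a/d]≡a : ∀ a d .{{_ : NonZero d}} → ℤ→ℚ (+ d) * (a / d) ≡ ℤ→ℚ a
  d*[a/d]≡a a d = begin
    ℤ→ℚ (+ d) * (a / d)                   ≡⟨ cong (ℤ→ℚ (+ d) *_) (/-as-* a d) ⟩
    ℤ→ℚ (+ d) * (ℤ→ℚ a * ((+ 1) / d))     ≡⟨ x∙yz≈y∙xz (ℤ→ℚ (+ d)) (ℤ→ℚ a) _ ⟩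
    ℤ→ℚ a * (ℤ→ℚ (+ d) * ((+ 1) / d))     ≡⟨ cong (ℤ→ℚ a *_) (d*[1/d]≡1 d) ⟩
    ℤ→ℚ a * 1ℚ                            ≡⟨ ℚP.*-identityʳ (ℤ→ℚ a) ⟩
    ℤ→ℚ a                                 ∎
    where open ≡-Reasoning

  a*[b/d]≡ab/d : ∀ a b d .{{_ : NonZero d}} → ℤ→ℚ a * (b / d) ≡ (a ℤ.* b) / d
  a*[b/d]≡ab/d a b d = sym (begin
    (a ℤ.* b) / d                         ≡⟨ /-as-* (a ℤ.* b) d ⟩
    ℤ→ℚ (a ℤ.* b) * ((+ 1) / d)           ≡⟨ cong (_* ((+ 1) / d)) (ℤ→ℚ-homo-* a b) ⟩
    ℤ→ℚ a * ℤ→ℚ b * ((+ 1) / d)           ≡⟨ ℚP.*-assoc (ℤ→ℚ a) (ℤ→ℚ b) _ ⟩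
    ℤ→ℚ a * (ℤ→ℚ b * ((+ 1) / d))         ≡⟨ cong (ℤ→ℚ a *_) (/-as-* b d) ⟨
    ℤ→ℚ a * (b / d)                       ∎)
    where open ≡-Reasoning

  ℤ→ℚ≡mkℚ : ∀ a → ℤ→ℚ a ≡ ℚ.mkℚ a 0 (ℕCoprimality.sym (ℕCoprimality.1-coprimeTo _))
  ℤ→ℚ≡mkℚ a = ℚP.↥p/↧p≡p (ℚ.mkℚ a 0 (ℕCoprimality.sym (ℕCoprimality.1-coprimeTo _)))

  ℤ→ℚ-injective : ∀ {a b} → ℤ→ℚ a ≡ ℤ→ℚ b → a ≡ b
  ℤ→ℚ-injective {a} {b} eq = cong ℚ.↥_ (trans (sym (ℤ→ℚ≡mkℚ a)) (trans eq (ℤ→ℚ≡mkℚ b)))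

  ℤ→ℚ-mono-≤ : ∀ {a b} → a ℤ.≤ b → ℤ→ℚ a ≤ ℤ→ℚ b
  ℤ→ℚ-mono-≤ {a} {b} a≤b rewrite ℤ→ℚ≡mkℚ a | ℤ→ℚ≡mkℚ b =
    ℚ.*≤* (subst₂ ℤ._≤_ (sym (ℤP.*-identityʳ a)) (sym (ℤP.*-identityʳ b)) a≤b)

  ℤ→ℚ-cancel-≤ : ∀ {a b} → ℤ→ℚ a ≤ ℤ→ℚ b → a ℤ.≤ b
  ℤ→ℚ-cancel-≤ {a} {b} a≤b rewrite ℤ→ℚ≡mkℚ a | ℤ→ℚ≡mkℚ b =
    subst₂ ℤ._≤_ (ℤP.*-identityʳ a) (ℤP.*-identityʳ b) (ℚP.drop-*≤* a≤b)

  ℤ→ℚ-mono-< : ∀ {a b} → a ℤ.< b → ℤ→ℚ a < ℤ→ℚ b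
  ℤ→ℚ-mono-< {a} {b} a<b rewrite ℤ→ℚ≡mkℚ a | ℤ→ℚ≡mkℚ b =
    ℚ.*<* (subst₂ ℤ._<_ (sym (ℤP.*-identityʳ a)) (sym (ℤP.*-identityʳ b)) a<b)

  ℤ→ℚ-cancel-< : ∀ {a b} → ℤ→ℚ a < ℤ→ℚ b → a ℤ.< b
  ℤ→ℚ-cancel-< {a} {b} a<b rewrite ℤ→ℚ≡mkℚ a | ℤ→ℚ≡mkℚ b =
    subst₂ ℤ._<_ (ℤP.*-identityʳ a) (ℤP.*-identityʳ b) (ℚP.drop-*<* a<b)

  ℤ→ℚ-quadratic : ∀ w a b y c →
    ℤ→ℚ (w ℤ.* w ℤ.+ a ℤ.* w ℤ.+ b ℤ.* y ℤ.+ c)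
    ≡ ℤ→ℚ w * ℤ→ℚ w + ℤ→ℚ a * ℤ→ℚ w + ℤ→ℚ b * ℤ→ℚ y + ℤ→ℚ c
  ℤ→ℚ-quadratic w a b y c = begin
    ℤ→ℚ (w ℤ.* w ℤ.+ a ℤ.* w ℤ.+ b ℤ.* y ℤ.+ c)
      ≡⟨ ℤ→ℚ-homo-+ (w ℤ.* w ℤ.+ a ℤ.* w ℤ.+ b ℤ.* y) c ⟩
    ℤ→ℚ (w ℤ.* w ℤ.+ a ℤ.* w ℤ.+ b ℤ.* y) + ℤ→ℚ c
      ≡⟨ cong (_+ ℤ→ℚ c) (ℤ→ℚ-homo-+ (w ℤ.* w ℤ.+ a ℤ.* w) (b ℤ.* y)) ⟩
    ℤ→ℚ (w ℤ.* w ℤ.+ a ℤ.* w) + ℤ→ℚ (b ℤ.* y) + ℤ→ℚ c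
      ≡⟨ cong (λ z → z + ℤ→ℚ (b ℤ.* y) + ℤ→ℚ c) (ℤ→ℚ-homo-+ (w ℤ.* w) (a ℤ.* w)) ⟩
    ℤ→ℚ (w ℤ.* w) + ℤ→ℚ (a ℤ.* w) + ℤ→ℚ (b ℤ.* y) + ℤ→ℚ c
      ≡⟨ cong₂ (λ u v → u + v + ℤ→ℚ (b ℤ.* y) + ℤ→ℚ c) (ℤ→ℚ-homo-* w w) (ℤ→ℚ-homo-* a w) ⟩
    ℤ→ℚ w * ℤ→ℚ w + ℤ→ℚ a * ℤ→ℚ w + ℤ→ℚ (b ℤ.* y) + ℤ→ℚ c
      ≡⟨ cong (λ z → ℤ→ℚ w * ℤ→ℚ w + ℤ→ℚ a * ℤ→ℚ w + z + ℤ→ℚ c) (ℤ→ℚ-homo-* b y) ⟩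
    ℤ→ℚ w * ℤ→ℚ w + ℤ→ℚ a * ℤ→ℚ w + ℤ→ℚ b * ℤ→ℚ y + ℤ→ℚ c ∎
    where open ≡-Reasoning

  [d*a]/d≡a : ∀ a d .{{_ : NonZero d}} → (+ d ℤ.* a) / d ≡ ℤ→ℚ a
  [d*a]/d≡a a d = trans (sym (a*[b/d]≡ab/d (+ d) a d)) (d*[a/d]≡a a d)

  *-cancelʳ-≡-pos : ∀ {p q} r .{{_ : ℚ.Positive r}} → p * r ≡ q * r → p ≡ q
  *-cancelʳ-≡-pos r pr≡qr =
    ℚP.≤-antisym (ℚP.*-cancelʳ-≤-pos r (ℚP.≤-reflexive pr≡qr)) (ℚP.*-cancelʳ-≤-pos r (ℚP.≤-reflexive (sym pr≡qr)))

  *-cancelˡ-≡-pos : ∀ {p q} r .{{_ : ℚ.Positive r}} → r * p ≡ r * q → p ≡ q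
  *-cancelˡ-≡-pos r rp≡rq =
    ℚP.≤-antisym (ℚP.*-cancelˡ-≤-pos r (ℚP.≤-reflexive rp≡rq)) (ℚP.*-cancelˡ-≤-pos r (ℚP.≤-reflexive (sym rp≡rq)))

open IntegerEmbedding

module RationalIdentities where
  open import Data.Rational using (_+_; _*_; _-_)
  open import Data.Rational.Solver using (module +-*-Solver)
  open +-*-Solver

  two minus-two : ℚ
  two = ℤ→ℚ (+ 2)
  minus-two = ℤ→ℚ (ℤ.- (+ 2))

  scaled-quadratic : ∀ h r s d e f X Y {N M} → two * h ≡ N → N * r ≡ M → M * r ≡ s →
    two * N * (h * X * X + minus-two * h * r * X * Y + h * r * r * Y * Y + (d - h) * X + (e - s * ½) * Y + f)
    ≡ (N * X - M * Y) * (N * X - M * Y) + (two * d - N) * (N * X - M * Y)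
      + ((two * d - N) * M + two * N * e - M * M) * Y + two * N * f
  scaled-quadratic h r _ d e f X Y refl refl refl = solve 7 (λ h r d e f X Y →
      con two :* (con two :* h) :* (h :* X :* X :+ con minus-two :* h :* r :* X :* Y :+ h :* r :* r :* Y :* Y
        :+ (d :- h) :* X :+ (e :- con two :* h :* r :* r :* con ½) :* Y :+ f)
    := (con two :* h :* X :- con two :* h :* r :* Y) :* (con two :* h :* X :- con two :* h :* r :* Y)
        :+ (con two :* d :- con two :* h) :* (con two :* h :* X :- con two :* h :* r :* Y)
        :+ ((con two :* d :- con two :* h) :* (con two :* h :* r) :+ con two :* (con two :* h) :* e
            :- con two :* h :* r :* (con two :* h :* r)) :* Y
        :+ con two :* (con two :* h) :* f) refl h r d e f X Y

  scaled-linear : ∀ h r s d e {N M} → two * h ≡ N → N * r ≡ M → M * r ≡ s →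
    (d - h) * M + (e - s * ½) * N ≡ ((two * d - N) * M + two * N * e - M * M) * ½
  scaled-linear h r _ d e refl refl refl = solve 4 (λ h r d e →
      (d :- h) :* (con two :* h :* r) :+ (e :- con two :* h :* r :* r :* con ½) :* (con two :* h)
    := ((con two :* d :- con two :* h) :* (con two :* h :* r) :+ con two :* (con two :* h) :* e
        :- con two :* h :* r :* (con two :* h :* r)) :* con ½) refl h r d e

  sheared-quadratic : ∀ h r d e f x y →
    h * (x + r * y) * (x + r * y) + minus-two * h * r * (x + r * y) * y + h * r * r * y * y
      + d * (x + r * y) + e * y + f
    ≡ h * x * x + d * x + (d * r + e) * y + f
  sheared-quadratic = solve 7 (λ h r d e f x y →
      h :* (x :+ r :* y) :* (x :+ r :* y) :+ con minus-two :* h :* r :* (x :+ r :* y) :* y :+ h :* r :* r :* y :* y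
        :+ d :* (x :+ r :* y) :+ e :* y :+ f
    := h :* x :* x :+ d :* x :+ (d :* r :+ e) :* y :+ f) refl

  target-expansion : ∀ h x y Z u f →
    h * x * x + (1ℚ - Z * (h * u)) * x + Z * u * y + f ≡ h * x * (x - Z * u) + x + Z * u * y + f
  target-expansion = solve 6 (λ h x y Z u f →
      h :* x :* x :+ (con 1ℚ :- Z :* (h :* u)) :* x :+ Z :* u :* y :+ f
    := h :* x :* (x :- Z :* u) :+ x :+ Z :* u :* y :+ f) refl

  half-affine : ∀ d N {Z} → Z ≡ two - (two * d - N) → d - N * ½ ≡ 1ℚ - Z * ½
  half-affine d N refl = solve 2 (λ d N →
      d :- N :* con ½ := con 1ℚ :- (con two :- (con two :* d :- N)) :* con ½) refl d N

  *-distribʳ-linear : ∀ d e a b c → (d * a + e * b) * c ≡ d * (a * c) + e * (b * c)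
  *-distribʳ-linear = solve 5 (λ d e a b c → (d :* a :+ e :* b) :* c := d :* (a :* c) :+ e :* (b :* c)) refl

  *-rotate : ∀ a b c → a * b * c ≡ c * a * b
  *-rotate = solve 3 (λ a b c → a :* b :* c := c :* a :* b) refl

  halve-double : ∀ a b → two * (a * b) * ½ ≡ a * b
  halve-double = solve 2 (λ a b → con two :* (a :* b) :* con ½ := a :* b) refl

open RationalIdentities

module Prop6Algebra (m n : ℕ) .{{_ : NonZero m}} .{{_ : NonZero n}} (D E F : ℤ) where
  open Prop6 m n D E F
  open import Data.Rational using (_+_; _*_; _-_)

  N M : ℚ
  N = ℤ→ℚ (+ n)
  M = ℤ→ℚ (+ (m ∸ 1))

  -- 2n P(x, y) = Wn² + α Wn + β y + 2n F  with  Wn = n x − (m − 1) y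
  α β : ℤ
  α = + 2 ℤ.* D ℤ.- + n
  β = α ℤ.* + (m ∸ 1) ℤ.+ + 2 ℤ.* + n ℤ.* E ℤ.- + (m ∸ 1) ℤ.* + (m ∸ 1)

  Wn : Point → ℤ
  Wn (x , y) = + n ℤ.* x ℤ.- + (m ∸ 1) ℤ.* y

  Qn : Point → ℤ
  Qn (x , y) = Wn (x , y) ℤ.* Wn (x , y) ℤ.+ α ℤ.* Wn (x , y) ℤ.+ β ℤ.* y

  2*n/2≡N : two * n/2 ≡ N
  2*n/2≡N = d*[a/d]≡a (+ n) 2

  N*r≡M : N * r ≡ M
  N*r≡M = d*[a/d]≡a (+ (m ∸ 1)) n

  M*r≡sq : M * r ≡ (+ ((m ∸ 1) ℕ.* (m ∸ 1))) / n
  M*r≡sq = trans (a*[b/d]≡ab/d (+ (m ∸ 1)) (+ (m ∸ 1)) n) (cong (_/ n) (sym (ℤP.pos-* (m ∸ 1) (m ∸ 1))))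

  ℤ→ℚ-α : ℤ→ℚ α ≡ two * ℤ→ℚ D - N
  ℤ→ℚ-α = trans (ℤ→ℚ-homo-− (+ 2 ℤ.* D) (+ n)) (cong (_- N) (ℤ→ℚ-homo-* (+ 2) D))

  ℤ→ℚ-β : ℤ→ℚ β ≡ (two * ℤ→ℚ D - N) * M + two * N * ℤ→ℚ E - M * M
  ℤ→ℚ-β = begin
    ℤ→ℚ β
      ≡⟨ ℤ→ℚ-homo-− (α ℤ.* + (m ∸ 1) ℤ.+ + 2 ℤ.* + n ℤ.* E) (+ (m ∸ 1) ℤ.* + (m ∸ 1)) ⟩
    ℤ→ℚ (α ℤ.* + (m ∸ 1) ℤ.+ + 2 ℤ.* + n ℤ.* E) - ℤ→ℚ (+ (m ∸ 1) ℤ.* + (m ∸ 1))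
      ≡⟨ cong₂ _-_ (ℤ→ℚ-homo-+ (α ℤ.* + (m ∸ 1)) (+ 2 ℤ.* + n ℤ.* E))
                   (ℤ→ℚ-homo-* (+ (m ∸ 1)) (+ (m ∸ 1))) ⟩
    ℤ→ℚ (α ℤ.* + (m ∸ 1)) + ℤ→ℚ (+ 2 ℤ.* + n ℤ.* E) - M * M
      ≡⟨ cong₂ (λ a b → a + b - M * M)
           (trans (ℤ→ℚ-homo-* α (+ (m ∸ 1))) (cong (_* M) ℤ→ℚ-α))
           (trans (ℤ→ℚ-homo-* (+ 2 ℤ.* + n) E) (cong (_* ℤ→ℚ E) (ℤ→ℚ-homo-* (+ 2) (+ n)))) ⟩
    (two * ℤ→ℚ D - N) * M + two * N * ℤ→ℚ E - M * M ∎
    where open ≡-Reasoning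

  ℤ→ℚ-Wn : ∀ x y → ℤ→ℚ (Wn (x , y)) ≡ N * ℤ→ℚ x - M * ℤ→ℚ y
  ℤ→ℚ-Wn x y = trans (ℤ→ℚ-homo-− (+ n ℤ.* x) (+ (m ∸ 1) ℤ.* y))
                     (cong₂ _-_ (ℤ→ℚ-homo-* (+ n) x) (ℤ→ℚ-homo-* (+ (m ∸ 1)) y))

  scaled-P : ∀ x y →
    ℤ→ℚ (+ 2 ℤ.* + n) * eval P (ℤ→ℚ x) (ℤ→ℚ y) ≡ ℤ→ℚ (Qn (x , y) ℤ.+ + 2 ℤ.* + n ℤ.* F)
  scaled-P x y = begin
    ℤ→ℚ (+ 2 ℤ.* + n) * eval P X Y
      ≡⟨ cong (_* eval P X Y) (ℤ→ℚ-homo-* (+ 2) (+ n)) ⟩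
    two * N * eval P X Y
      ≡⟨ scaled-quadratic n/2 r _ (ℤ→ℚ D) (ℤ→ℚ E) (ℤ→ℚ F) X Y 2*n/2≡N N*r≡M M*r≡sq ⟩
    (N * X - M * Y) * (N * X - M * Y) + (two * ℤ→ℚ D - N) * (N * X - M * Y)
      + ((two * ℤ→ℚ D - N) * M + two * N * ℤ→ℚ E - M * M) * Y + two * N * ℤ→ℚ F
      ≡⟨ cong₂ (λ w b → w * w + (two * ℤ→ℚ D - N) * w + b * Y + two * N * ℤ→ℚ F)
           (sym (ℤ→ℚ-Wn x y)) (sym ℤ→ℚ-β) ⟩
    ℤ→ℚ W * ℤ→ℚ W + (two * ℤ→ℚ D - N) * ℤ→ℚ W + ℤ→ℚ β * Y + two * N * ℤ→ℚ F
      ≡⟨ cong (λ a → ℤ→ℚ W * ℤ→ℚ W + a * ℤ→ℚ W + ℤ→ℚ β * Y + two * N * ℤ→ℚ F) (sym ℤ→ℚ-α) ⟩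
    ℤ→ℚ W * ℤ→ℚ W + ℤ→ℚ α * ℤ→ℚ W + ℤ→ℚ β * Y + two * N * ℤ→ℚ F
      ≡⟨ cong (λ c → ℤ→ℚ W * ℤ→ℚ W + ℤ→ℚ α * ℤ→ℚ W + ℤ→ℚ β * Y + c) (sym ℤ→ℚ-2nF) ⟩
    ℤ→ℚ W * ℤ→ℚ W + ℤ→ℚ α * ℤ→ℚ W + ℤ→ℚ β * Y + ℤ→ℚ (+ 2 ℤ.* + n ℤ.* F)
      ≡⟨ sym (ℤ→ℚ-quadratic W α β y (+ 2 ℤ.* + n ℤ.* F)) ⟩
    ℤ→ℚ (Qn (x , y) ℤ.+ + 2 ℤ.* + n ℤ.* F) ∎
    where
    open ≡-Reasoning
    X Y : ℚ
    X = ℤ→ℚ x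
    Y = ℤ→ℚ y
    W : ℤ
    W = Wn (x , y)
    ℤ→ℚ-2nF : ℤ→ℚ (+ 2 ℤ.* + n ℤ.* F) ≡ two * N * ℤ→ℚ F
    ℤ→ℚ-2nF = trans (ℤ→ℚ-homo-* (+ 2 ℤ.* + n) F) (cong (_* ℤ→ℚ F) (ℤ→ℚ-homo-* (+ 2) (+ n)))

  L : ℚ
  L = ℤ→ℚ (+ l)

  k*l≡dd*M+ee*N : k * L ≡ dd * M + ee * N
  k*l≡dd*M+ee*N = begin
    (dd * ((+ (m ∸ 1)) / l) + ee * ((+ n) / l)) * L
      ≡⟨ *-distribʳ-linear dd ee _ _ L ⟩
    dd * ((+ (m ∸ 1)) / l * L) + ee * ((+ n) / l * L)
      ≡⟨ cong₂ (λ a b → dd * a + ee * b) (cancel (+ (m ∸ 1))) (cancel (+ n)) ⟩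
    dd * M + ee * N ∎
    where
    open ≡-Reasoning
    cancel : ∀ a → a / l * L ≡ ℤ→ℚ a
    cancel a = trans (ℚP.*-comm (a / l) L) (d*[a/d]≡a a l)

  k*l≡β/2 : k * L ≡ ℤ→ℚ β * ½
  k*l≡β/2 = trans k*l≡dd*M+ee*N
    (trans (scaled-linear n/2 r _ (ℤ→ℚ D) (ℤ→ℚ E) 2*n/2≡N N*r≡M M*r≡sq) (cong (_* ½) (sym ℤ→ℚ-β)))

  n/2*[1/n]≡½ : n/2 * ((+ 1) / n) ≡ ½
  n/2*[1/n]≡½ = begin
    n/2 * ((+ 1) / n)           ≡⟨ cong (_* ((+ 1) / n)) (/-as-* (+ n) 2) ⟩
    N * ½ * ((+ 1) / n)         ≡⟨ xy∙z≈y∙xz N ½ _ ⟩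
    ½ * (N * ((+ 1) / n))       ≡⟨ cong (½ *_) (d*[1/d]≡1 n) ⟩
    ½ * 1ℚ                      ≡⟨ ℚP.*-identityʳ ½ ⟩
    ½                           ∎
    where open ≡-Reasoning

  dd*r+ee≡k*l/n : dd * r + ee ≡ k * L * ((+ 1) / n)
  dd*r+ee≡k*l/n = sym (begin
    k * L * u                    ≡⟨ cong (_* u) k*l≡dd*M+ee*N ⟩
    (dd * M + ee * N) * u        ≡⟨ *-distribʳ-linear dd ee M N u ⟩
    dd * (M * u) + ee * (N * u)  ≡⟨ cong₂ (λ a b → dd * a + ee * b) (sym (/-as-* (+ (m ∸ 1)) n)) (d*[1/d]≡1 n) ⟩
    dd * r + ee * 1ℚ             ≡⟨ cong (λ e → dd * r + e) (ℚP.*-identityʳ ee) ⟩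
    dd * r + ee                  ∎)
    where
    open ≡-Reasoning
    u : ℚ
    u = (+ 1) / n

  k*l≡2-α : ∀ K → k ≡ ℤ→ℚ K → α ≡ + 2 ℤ.- K ℤ.* + l → k * L ≡ two - (two * ℤ→ℚ D - N)
  k*l≡2-α K k≡K α≡2-Kl = begin
    k * L                     ≡⟨ cong (_* L) k≡K ⟩
    ℤ→ℚ K * L                 ≡⟨ ℤ→ℚ-homo-* K (+ l) ⟨
    ℤ→ℚ (K ℤ.* + l)           ≡⟨ cong ℤ→ℚ (swap {b = K ℤ.* + l} α≡2-Kl) ⟩
    ℤ→ℚ (+ 2 ℤ.- α)           ≡⟨ ℤ→ℚ-homo-− (+ 2) α ⟩
    two - ℤ→ℚ α               ≡⟨ cong (two -_) ℤ→ℚ-α ⟩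
    two - (two * ℤ→ℚ D - N)   ∎
    where
    open ≡-Reasoning
    swap : ∀ {a b} → a ≡ + 2 ℤ.- b → b ≡ + 2 ℤ.- a
    swap {b = b} refl = ℤ-RingSolver.solve (b ∷ [])

  Phat≡target : ∀ K → k ≡ ℤ→ℚ K → α ≡ + 2 ℤ.- K ℤ.* + l → ∀ x y → Phat x y ≡ target x y
  Phat≡target K k≡K α≡2-Kl x y = begin
    Phat x y
      ≡⟨ sheared-quadratic n/2 r dd ee (ℤ→ℚ F) x y ⟩
    n/2 * x * x + dd * x + (dd * r + ee) * y + ℤ→ℚ F
      ≡⟨ cong₂ (λ a b → n/2 * x * x + a * x + b * y + ℤ→ℚ F) dd≡ dd*r+ee≡k*l/n ⟩
    n/2 * x * x + (1ℚ - k * L * (n/2 * ((+ 1) / n))) * x + k * L * ((+ 1) / n) * y + ℤ→ℚ F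
      ≡⟨ target-expansion n/2 x y (k * L) ((+ 1) / n) (ℤ→ℚ F) ⟩
    target x y ∎
    where
    open ≡-Reasoning
    dd≡ : dd ≡ 1ℚ - k * L * (n/2 * ((+ 1) / n))
    dd≡ = begin
      ℤ→ℚ D - n/2                             ≡⟨ cong (ℤ→ℚ D -_) (/-as-* (+ n) 2) ⟩
      ℤ→ℚ D - N * ½                           ≡⟨ half-affine (ℤ→ℚ D) N (k*l≡2-α K k≡K α≡2-Kl) ⟩
      1ℚ - k * L * ½                          ≡⟨ cong (λ h → 1ℚ - k * L * h) n/2*[1/n]≡½ ⟨
      1ℚ - k * L * (n/2 * ((+ 1) / n))        ∎


module QPPConsequences (m n : ℕ) .{{_ : NonZero m}} .{{_ : NonZero n}} (D E F : ℤ)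
  (qpp : IsQPP ((+ n) / m) (Prop6.P m n D E F)) (0<k : 0ℚ ℚ.< Prop6.k m n D E F) where
  open Prop6 m n D E F
  open Prop6Algebra m n D E F
  open import Data.Integer using (_+_; _*_; _-_; _≤_; _<_)
  open import Data.Integer.Divisibility.Signed using (_∣_; divides; ∣⇒∣ᵤ)

  g ρ : ℕ
  g = n ℕ./ l
  ρ = (m ∸ 1) ℕ./ l

  l*g≡n : l ℕ.* g ≡ n
  l*g≡n = m*[n/m]≡n (gcd[m,n]∣n (m ∸ 1) n)

  l*ρ≡m-1 : l ℕ.* ρ ≡ m ∸ 1
  l*ρ≡m-1 = m*[n/m]≡n (gcd[m,n]∣m (m ∸ 1) n)

  +n≡+l*+g : + n ≡ + l * + g
  +n≡+l*+g = trans (cong +_ (sym l*g≡n)) (ℤP.pos-* l g)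

  +m-1≡+l*+ρ : + (m ∸ 1) ≡ + l * + ρ
  +m-1≡+l*+ρ = trans (cong +_ (sym l*ρ≡m-1)) (ℤP.pos-* l ρ)

  open Wedge (+ l) (+ g) (+ ρ)

  Wn≡W : ∀ p → Wn p ≡ W p
  Wn≡W (x , y) = begin
    + n * x - + (m ∸ 1) * y                 ≡⟨ cong₂ (λ a b → a * x - b * y) +n≡+l*+g +m-1≡+l*+ρ ⟩
    + l * + g * x - + l * + ρ * y           ≡⟨ factor (+ l) (+ g) (+ ρ) x y ⟩
    + l * (+ g * x - + ρ * y)               ∎
    where
    open ≡-Reasoning
    factor : ∀ l g ρ x y → l * g * x - l * ρ * y ≡ l * (g * x - ρ * y)
    factor = ℤ-RingSolver.solve-∀

  Qn≡Q : ∀ p → Qn p ≡ Q α β p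
  Qn≡Q p@(_ , y) = cong (λ w → w * w + α * w + β * y) (Wn≡W p)

  slope : ℚ
  slope = (+ n) / m

  instance
    m>0 : ℚ.Positive (ℤ→ℚ (+ m))
    m>0 = ℚ.positive (ℤ→ℚ-mono-< (+<+ (ℕ.>-nonZero⁻¹ m)))
    m≥0 : ℚ.NonNegative (ℤ→ℚ (+ m))
    m≥0 = ℚP.pos⇒nonNeg (ℤ→ℚ (+ m))

  below-slope : ∀ x y →
    ℤ→ℚ y ℚ.* ℤ→ℚ (+ m) ≡ ℤ→ℚ (y * + m) × slope ℚ.* ℤ→ℚ x ℚ.* ℤ→ℚ (+ m) ≡ ℤ→ℚ (+ n * x)
  below-slope x y = sym (ℤ→ℚ-homo-* y (+ m)) , (begin
    slope ℚ.* ℤ→ℚ x ℚ.* ℤ→ℚ (+ m)    ≡⟨ *-rotate slope (ℤ→ℚ x) (ℤ→ℚ (+ m)) ⟩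
    ℤ→ℚ (+ m) ℚ.* slope ℚ.* ℤ→ℚ x    ≡⟨ cong (ℚ._* ℤ→ℚ x) (d*[a/d]≡a (+ n) m) ⟩
    ℤ→ℚ (+ n) ℚ.* ℤ→ℚ x              ≡⟨ ℤ→ℚ-homo-* (+ n) x ⟨
    ℤ→ℚ (+ n * x)                    ∎)
    where open ≡-Reasoning

  gap-form : ∀ x y → + n * x - y * + m ≡ W (x , y) - y
  gap-form x y = begin
    + n * x - y * + m                        ≡⟨ cong (λ c → + n * x - y * c) +m≡+m-1+1 ⟩
    + n * x - y * (+ (m ∸ 1) + + 1)          ≡⟨ expand (+ n) (+ (m ∸ 1)) x y ⟩
    Wn (x , y) - y                           ≡⟨ cong (_- y) (Wn≡W (x , y)) ⟩
    W (x , y) - y                            ∎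
    where
    open ≡-Reasoning
    +m≡+m-1+1 : + m ≡ + (m ∸ 1) + + 1
    +m≡+m-1+1 = trans (cong +_ (sym (ℕP.m∸n+n≡m (ℕ.>-nonZero⁻¹ m)))) (ℤP.pos-+ (m ∸ 1) 1)
    expand : ∀ a b x y → a * x - y * (b + + 1) ≡ (a * x - b * y) - y
    expand = ℤ-RingSolver.solve-∀

  -- y ≤ (n/m) x  ⟺  m y ≤ n x  ⟺  y ≤ n x − (m − 1) y
  InI⇒InWedge : ∀ {p} → InI slope p → InWedge p
  InI⇒InWedge {x , y} (0≤y , y≤slope*x) = ℤ→ℚ-cancel-≤ 0≤y ,
    0≤-⇒≤ (subst (0ℤ ≤_) (gap-form x y) (≤⇒0≤- (ℤ→ℚ-cancel-≤ {y * + m} {+ n * x}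
      (subst₂ ℚ._≤_ (proj₁ (below-slope x y)) (proj₂ (below-slope x y))
        (ℚP.*-monoʳ-≤-nonNeg (ℤ→ℚ (+ m)) y≤slope*x)))))

  InWedge⇒InI : ∀ {p} → InWedge p → InI slope p
  InWedge⇒InI {x , y} (0≤y , y≤W) = ℤ→ℚ-mono-≤ 0≤y ,
    ℚP.*-cancelʳ-≤-pos (ℤ→ℚ (+ m))
      (subst₂ ℚ._≤_ (sym (proj₁ (below-slope x y))) (sym (proj₂ (below-slope x y)))
      (ℤ→ℚ-mono-≤ (0≤-⇒≤ {y * + m} {+ n * x} (subst (0ℤ ≤_) (sym (gap-form x y)) (≤⇒0≤- y≤W)))))

  C : ℤ
  C = + 2 * + n * F

  integral-value : ∀ x y (N₀ : ℕ) →
    eval P (ℤ→ℚ x) (ℤ→ℚ y) ≡ ℕ→ℚ N₀ → Q α β (x , y) + C ≡ + 2 * + n * + N₀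
  integral-value x y N₀ P≡N₀ = trans (cong (_+ C) (sym (Qn≡Q (x , y)))) (ℤ→ℚ-injective (begin
    ℤ→ℚ (Qn (x , y) + C)                             ≡⟨ scaled-P x y ⟨
    ℤ→ℚ (+ 2 * + n) ℚ.* eval P (ℤ→ℚ x) (ℤ→ℚ y)       ≡⟨ cong (ℤ→ℚ (+ 2 * + n) ℚ.*_) P≡N₀ ⟩
    ℤ→ℚ (+ 2 * + n) ℚ.* ℤ→ℚ (+ N₀)                   ≡⟨ ℤ→ℚ-homo-* (+ 2 * + n) (+ N₀) ⟨
    ℤ→ℚ (+ 2 * + n * + N₀)                           ∎))
    where open ≡-Reasoning

  value : ∀ {x y} → InWedge (x , y) → ∃ λ N₀ → Q α β (x , y) + C ≡ + 2 * + n * + N₀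
  value {x} {y} p∈ =
    let N₀ , P≡N₀ = proj₁ (proj₂ qpp) (x , y) (InWedge⇒InI p∈) in N₀ , integral-value x y N₀ P≡N₀

  Q-injective : ∀ {p p′} → InWedge p → InWedge p′ → Q α β p ≡ Q α β p′ → p ≡ p′
  Q-injective {x , y} {x′ , y′} p∈ p′∈ Q≡Q′ =
    proj₁ (proj₂ (proj₂ qpp)) (x , y) (x′ , y′) (InWedge⇒InI p∈) (InWedge⇒InI p′∈)
      (*-cancelˡ-≡-pos (ℤ→ℚ (+ 2 * + n))
        (trans (scaled-P x y) (trans (cong (λ q → ℤ→ℚ (q + C)) Qn≡Qn′) (sym (scaled-P x′ y′)))))
    where
    instance
      2n>0 : ℚ.Positive (ℤ→ℚ (+ 2 * + n))
      2n>0 = ℚ.positive (subst (λ z → 0ℚ ℚ.< ℤ→ℚ z) (ℤP.pos-* 2 n)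
        (ℤ→ℚ-mono-< (+<+ (ℕ.>-nonZero⁻¹ (2 ℕ.* n) {{ℕP.m*n≢0 2 n}}))))
    Qn≡Qn′ : Qn (x , y) ≡ Qn (x′ , y′)
    Qn≡Qn′ = trans (Qn≡Q (x , y)) (trans Q≡Q′ (sym (Qn≡Q (x′ , y′))))

  1≤l : + 1 ≤ + l
  1≤l = +≤+ (ℕ.>-nonZero⁻¹ l)

  instance
    g≢0 : ℕ.NonZero g
    g≢0 = ℕ.≢-nonZero λ g≡0 →
      ℕ.≢-nonZero⁻¹ n (trans (sym l*g≡n) (trans (cong (l ℕ.*_) g≡0) (ℕP.*-zeroʳ l)))

  1≤g : + 1 ≤ + g
  1≤g = +≤+ (ℕ.>-nonZero⁻¹ g)

  W-origin : W (+ 1 , 0ℤ) ≡ + l * + g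
  W-origin = lemma (+ l) (+ g) (+ ρ)
    where
    lemma : ∀ l g ρ → l * (g * + 1 - ρ * 0ℤ) ≡ l * g
    lemma = ℤ-RingSolver.solve-∀

  origin∈ : InWedge (+ 1 , 0ℤ)
  origin∈ = 0≤+ 0 , subst (0ℤ ≤_) (sym W-origin) (0≤-* (0≤+ l) (0≤+ g))

  shifted-origin∈ : InWedge (shift (+ 1 , 0ℤ))
  shifted-origin∈ = 0≤+ g , subst (+ g ≤_) (sym (trans (W-shift (+ 1 , 0ℤ)) W-origin)) (i≤j*i 1≤l (0≤+ g))

  N₁ N₂ : ℤ
  N₁ = + proj₁ (value origin∈)
  N₂ = + proj₁ (value shifted-origin∈)

  -- the increment of P along the direction (ρ, g), on which W is constant
  K : ℤ
  K = N₂ - N₁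

  2n*K≡2Kl*g : + 2 * + n * K ≡ + 2 * (K * + l) * + g
  2n*K≡2Kl*g = trans (cong (λ c → + 2 * c * K) +n≡+l*+g) (reorder (+ l) (+ g) K)
    where
    reorder : ∀ l g K → + 2 * (l * g) * K ≡ + 2 * (K * l) * g
    reorder = ℤ-RingSolver.solve-∀

  β≡2Kl : β ≡ + 2 * (K * + l)
  β≡2Kl = ℤP.*-cancelʳ-≡ β (+ 2 * (K * + l)) (+ g) (trans
    (shift-difference {q₁ = Q α β (+ 1 , 0ℤ)} {b = β * + g} {C} {+ 2 * + n} {N₁} {N₂}
      (Q-shift α β (+ 1 , 0ℤ)) (proj₂ (value origin∈)) (proj₂ (value shifted-origin∈)))
    2n*K≡2Kl*g)

  k≡K : k ≡ ℤ→ℚ K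
  k≡K = *-cancelʳ-≡-pos L (begin
    k ℚ.* L                           ≡⟨ k*l≡β/2 ⟩
    ℤ→ℚ β ℚ.* ½                       ≡⟨ cong (λ b → ℤ→ℚ b ℚ.* ½) β≡2Kl ⟩
    ℤ→ℚ (+ 2 * (K * + l)) ℚ.* ½       ≡⟨ cong (ℚ._* ½) (trans (ℤ→ℚ-homo-* (+ 2) (K * + l))
                                                              (cong (two ℚ.*_) (ℤ→ℚ-homo-* K (+ l)))) ⟩
    two ℚ.* (ℤ→ℚ K ℚ.* L) ℚ.* ½       ≡⟨ halve-double (ℤ→ℚ K) L ⟩
    ℤ→ℚ K ℚ.* L                       ∎)
    where
    open ≡-Reasoning
    instance
      L>0 : ℚ.Positive L
      L>0 = ℚ.positive (ℤ→ℚ-mono-< (+<+ (ℕ.>-nonZero⁻¹ l)))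

  0<K : 0ℤ < K
  0<K = ℤ→ℚ-cancel-< (subst (0ℚ ℚ.<_) k≡K 0<k)

  Qᴷ : Point → ℤ
  Qᴷ = Q α (+ 2 * (K * + l))

  Q≡Qᴷ : ∀ p → Q α β p ≡ Qᴷ p
  Q≡Qᴷ p = cong (λ b → Q α b p) β≡2Kl

  successor : ∀ {p} → InWedge p → ∃ λ p′ → InWedge p′ × Qᴷ p′ ≡ Qᴷ p + + 2 * (K * + l) * + g
  successor {p} p∈ =
    let N₀ , value-p = value p∈
        (x′ , y′) , p′∈I , P≡N₀+K = proj₂ (proj₂ (proj₂ qpp)) (N₀ ℕ.+ ℤ.∣ K ∣)
        value-p′ = trans (integral-value x′ y′ _ P≡N₀+K) (cong (λ z → + 2 * + n * z) (+N₀+∣K∣ N₀))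
    in (x′ , y′) , InI⇒InWedge p′∈I , (begin
      Qᴷ (x′ , y′)                       ≡⟨ Q≡Qᴷ (x′ , y′) ⟨
      Q α β (x′ , y′)                    ≡⟨ value-step {q = Q α β p} {c = C} {t = + 2 * + n} {N₀ = + N₀} {κ = K} value-p value-p′ ⟩
      Q α β p + + 2 * + n * K            ≡⟨ cong₂ _+_ (Q≡Qᴷ p) 2n*K≡2Kl*g ⟩
      Qᴷ p + + 2 * (K * + l) * + g       ∎)
    where
    open ≡-Reasoning
    +N₀+∣K∣ : ∀ N₀ → + (N₀ ℕ.+ ℤ.∣ K ∣) ≡ + N₀ + K
    +N₀+∣K∣ N₀ = trans (ℤP.pos-+ N₀ ℤ.∣ K ∣) (cong (λ z → + N₀ + z) (ℤP.0≤i⇒+∣i∣≡i (ℤP.<⇒≤ 0<K)))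

  open PackingArgument α K 1≤l 1≤g (0≤+ ρ) (ℤP.i<j⇒suc[i]≤j 0<K)
    (ℕCoprimality.sym (ℕCoprimality.coprime-/gcd (m ∸ 1) n)) successor
    (λ p∈ p′∈ Qᴷ≡Qᴷ′ → Q-injective p∈ p′∈ (trans (Q≡Qᴷ _) (trans Qᴷ≡Qᴷ′ (sym (Q≡Qᴷ _)))))
    using (conclusion)

  n/l∣l : (n ℕ./ l) ℕDivisibility.∣ l
  n/l∣l = ∣⇒∣ᵤ (proj₁ (proj₂ conclusion))

  Phat-formula : ∀ x y → Phat x y ≡ target x y
  Phat-formula = Phat≡target K k≡K (proj₁ conclusion)

  k-residue : ∃ λ t → k ≡ (+ (m ∸ 1)) / l ℚ.+ ℤ→ℚ t ℚ.* ((+ n) / l)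
  k-residue = from-divisibility (proj₂ (proj₂ conclusion))
    where
    open ≡-Reasoning
    move : ∀ {a b c} → a - b ≡ c → a ≡ b + c
    move {a} {b} refl = ℤ-RingSolver.solve (a ∷ b ∷ [])
    as-quotient : ∀ {a c} → + c ≡ + l * a → ℤ→ℚ a ≡ (+ c) / l
    as-quotient {a} c≡la = trans (sym ([d*a]/d≡a a l)) (cong (_/ l) (sym c≡la))
    from-divisibility : + g ∣ K - + ρ → ∃ λ t → k ≡ (+ (m ∸ 1)) / l ℚ.+ ℤ→ℚ t ℚ.* ((+ n) / l)
    from-divisibility (divides t K-ρ≡t*g) = t , (begin
      k                                         ≡⟨ k≡K ⟩
      ℤ→ℚ K                                     ≡⟨ cong ℤ→ℚ (move {K} {+ ρ} K-ρ≡t*g) ⟩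
      ℤ→ℚ (+ ρ + t * + g)                       ≡⟨ ℤ→ℚ-homo-+ (+ ρ) (t * + g) ⟩
      ℤ→ℚ (+ ρ) ℚ.+ ℤ→ℚ (t * + g)               ≡⟨ cong (ℤ→ℚ (+ ρ) ℚ.+_) (ℤ→ℚ-homo-* t (+ g)) ⟩
      ℤ→ℚ (+ ρ) ℚ.+ ℤ→ℚ t ℚ.* ℤ→ℚ (+ g)
        ≡⟨ cong₂ (λ a b → a ℚ.+ ℤ→ℚ t ℚ.* b) (as-quotient +m-1≡+l*+ρ) (as-quotient +n≡+l*+g) ⟩
      (+ (m ∸ 1)) / l ℚ.+ ℤ→ℚ t ℚ.* ((+ n) / l) ∎)

open import Data.Nat.Divisibility using (_∣_)
open import Data.Rational using (_+_; _*_; _<_)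

proposition6 : (m n : ℕ) .{{_ : NonZero m}} .{{_ : NonZero n}} → gcd m n ≡ 1 →
    (D E F : ℤ) →
    let open Prop6 m n D E F in
    IsQPP ((+ n) / m) P → 0ℚ < k →
    ((n ℕ./ l) ∣ l)
    × (∃ λ (t : ℤ) → k ≡ (+ (m ∸ 1)) / l + ℤ→ℚ t * ((+ n) / l))
    × (∀ (x y : ℚ) → Phat x y ≡ target x y)
proposition6 m n _ D E F qpp 0<k = n/l∣l , k-residue , Phat-formula
  where open QPPConsequences m n D E F qpp 0<k
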